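{- Let $G$ be a $C_{4k}$-free bipartite graph. If $I$ is a maximum independent set of $G$, then $I\cap\operatorname{Npart}(G)$ is a maximum independent set of $C_N(G)$ and $I\cap\operatorname{Supp}(G)$ is a maximum independent set of $C_S(G)$.
   Context: All graphs are finite, simple and undirected. A graph is a $C_{4k}$-free bipartite graph if it is bipartite and contains no cycle whose length is a multiple of $4$. For a graph $G$, $\operatorname{Null}(G)$ is the null space of its adjacency matrix, viewed as a subspace of $\mathbb{R}^{V(G)}$; $\operatorname{Supp}(G)$ is the set of vertices $v$ with $\vec{x}_v\neq0$ for some $\vec{x}\in\operatorname{Null}(G)$; $\operatorname{Core}(G)$ is the set of vertices adjacent to some vertex of $\operatorname{Supp}(G)$; $\operatorname{Npart}(G)=V(G)\setminus(\operatorname{Supp}(G)\cup\operatorname{Core}(G))$. $C_S(G)$ is the subgraph induced by $\operatorname{Supp}(G)\cup\operatorname{Core}(G)$ and $C_N(G)$ the subgraph induced by $\operatorname{Npart}(G)$.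
   Formalization: The null space of the adjacency matrix, which defines $\operatorname{Supp}(G)$, $\operatorname{Core}(G)$ and $\operatorname{Npart}(G)$, is taken over ℚ instead of ℝ. -}

module Defs where

open import Data.Nat using (ℕ; zero; suc; _≤_)
open import Data.Nat.Divisibility using (_∣_)
open import Data.Bool using (Bool; true; false; if_then_else_)
open import Data.Fin using (Fin; zero; suc)
open import Data.Fin.Subset using (Subset; _∈_; ∣_∣)
open import Data.List using (List; []; _∷_; length)
open import Data.List.Relation.Unary.Unique.Propositional using (Unique)
open import Data.Rational using (ℚ; 0ℚ; _+_)
open import Data.Product using (Σ; _×_; ∃)
open import Data.Sum using (_⊎_)
open import Data.Unit using (⊤)
open import Data.Empty using (⊥)
open import Relation.Nullary using (¬_)
open import Relation.Binary.PropositionalEquality using (_≡_; _≢_)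

record Graph (n : ℕ) : Set where
  field
    adj   : Fin n → Fin n → Bool
    sym   : ∀ i j → adj i j ≡ adj j i
    irrefl : ∀ i → adj i i ≡ false
open Graph public

Adjacent : ∀ {n} → Graph n → Fin n → Fin n → Set
Adjacent G u v = adj G u v ≡ true

IsBipartite : ∀ {n} → Graph n → Set
IsBipartite {n} G = Σ (Fin n → Bool) λ c → ∀ u v → Adjacent G u v → c u ≢ c v

IsWalk : ∀ {n} → Graph n → List (Fin n) → Set
IsWalk G [] = ⊤
IsWalk G (x ∷ []) = ⊤
IsWalk G (x ∷ y ∷ rest) = Adjacent G x y × IsWalk G (y ∷ rest)

lastOr : ∀ {n} → Fin n → List (Fin n) → Fin n
lastOr x [] = x
lastOr x (y ∷ ys) = lastOr y ys

-- A cycle v₀ v₁ … v_{m-1} v₀ with m ≥ 3 distinct vertices; its length is m.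
IsCycle : ∀ {n} → Graph n → List (Fin n) → Set
IsCycle G [] = ⊥
IsCycle G (x ∷ xs) =
  3 ≤ length (x ∷ xs) × Unique (x ∷ xs) × IsWalk G (x ∷ xs) × Adjacent G (lastOr x xs) x

IsC4kFree : ∀ {n} → Graph n → Set
IsC4kFree {n} G = ∀ (vs : List (Fin n)) → IsCycle G vs → ¬ (4 ∣ length vs)

sumℚ : ∀ {n} → (Fin n → ℚ) → ℚ
sumℚ {zero} f = 0ℚ
sumℚ {suc n} f = f zero + sumℚ (λ i → f (suc i))

InNull : ∀ {n} → Graph n → (Fin n → ℚ) → Set
InNull G x = ∀ i → sumℚ (λ j → if adj G i j then x j else 0ℚ) ≡ 0ℚ

Supp : ∀ {n} → Graph n → Fin n → Set
Supp {n} G v = Σ (Fin n → ℚ) λ x → InNull G x × x v ≢ 0ℚ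

Core : ∀ {n} → Graph n → Fin n → Set
Core {n} G v = ∃ λ u → Adjacent G v u × Supp G u

Npart : ∀ {n} → Graph n → Fin n → Set
Npart G v = ¬ Supp G v × ¬ Core G v

CSverts : ∀ {n} → Graph n → Fin n → Set
CSverts G v = Supp G v ⊎ Core G v

IsIndepIn : ∀ {n} → Graph n → (Fin n → Set) → Subset n → Set
IsIndepIn G S J = (∀ v → v ∈ J → S v) × (∀ u v → u ∈ J → v ∈ J → ¬ Adjacent G u v)

IsMaxIndepIn : ∀ {n} → Graph n → (Fin n → Set) → Subset n → Set
IsMaxIndepIn G S J = IsIndepIn G S J × (∀ K → IsIndepIn G S K → ∣ K ∣ ≤ ∣ J ∣)

IsInterWith : ∀ {n} → Subset n → (Fin n → Set) → Subset n → Set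
IsInterWith I S J = ∀ v → (v ∈ J → v ∈ I × S v) × (v ∈ I × S v → v ∈ J)

{-# OPTIONS --safe #-}
-- The key property of C₄ₖ-free graphs: if Y is matched into a set Z disjoint from Y, x is a null
-- vector, and every vertex in the support of x that is adjacent to Z lies in Y, then x vanishes on
-- Y. Otherwise pick y with x y ≠ 0. The row of A x at its partner m(y) sums to zero, so some
-- neighbour y′ ∈ Y of m(y) has x y′ of the opposite sign. Iterating this gives a cycle
-- y₀ m(y₀) y₁ m(y₁) … whose y's alternate in sign, so its length is divisible by 4.
--
-- Combined with Hall's theorem, this gives two facts. First, Supp ⊆ I for every maximum independent
-- set I: restrict a null vector to one colour class, let Y be its support outside I, and let
-- Z = N(Y) ∩ I. Maximality of I gives Hall's condition for Y into Z. Hence Core ∩ I = ∅, so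
-- I ─ Npart = I ∩ Supp, and any independent K ⊆ Npart can replace I ∩ Npart inside I. Second, for
-- nonempty X ⊆ Core the set N(X) ∩ Supp cannot be matched into X: apply the key property to a null
-- vector witnessing that a vertex of X lies in Core. Hall's theorem and induction then give
-- |X| ≤ |N(X) ∩ Supp|, which makes Supp = I ∩ Supp a maximum independent set of C_S.

module Submission where

open import Defs hiding (sym)
open import Data.Bool.Base using (Bool; true; false; not; if_then_else_)
import Data.Bool.Properties as Bool
open import Data.Empty using (⊥-elim)
open import Data.Fin.Base using (Fin; zero; suc)
open import Data.Fin.Properties as Fin using (any?)
open import Data.Fin.Subset renaming (⊤ to full)
open import Data.Fin.Subset.Properties
open import Data.List.Base using (List; []; _∷_; _∷ʳ_; length)
open import Data.List.Membership.Propositional using () renaming (_∈_ to _∈ₗ_; _∉_ to _∉ₗ_)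
open import Data.List.Membership.Propositional.Properties using (∈-++⁺ˡ; ∈-++⁺ʳ)
open import Data.List.Relation.Unary.All as All using (All; []; _∷_)
import Data.List.Relation.Unary.All.Properties as All
open import Data.List.Relation.Unary.AllPairs using ([]; _∷_)
open import Data.List.Relation.Unary.Any using (here; there)
open import Data.List.Relation.Unary.Linked as Linked using (Linked; []; [-]; _∷_)
open import Data.List.Relation.Unary.Unique.Propositional using (Unique)
import Data.List.Relation.Unary.Unique.Propositional.Properties as Unique
open import Data.Nat.Base using (ℕ; zero; suc; _+_; _*_; _≤_; _<_; z≤n; s≤s)
open import Data.Nat.Divisibility using (_∣_; ∣-refl; ∣m∣n⇒∣m+n; *-monoʳ-∣; ∣⇒≤)
open import Data.Nat.Induction using (<-wellFounded)
open import Data.Nat.Properties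
open import Data.Product using (∃-syntax; _×_; _,_; proj₁; proj₂)
open import Data.Rational.Base as ℚ using (ℚ; 0ℚ)
import Data.Rational.Properties as ℚ
open import Data.Sum using (_⊎_; inj₁; inj₂; [_,_])
open import Data.Unit using (⊤; tt)
open import Data.Vec.Base using ([]; _∷_; here; there; tabulate)
open import Data.Vec.Properties using (lookup∘tabulate; []=⇒lookup; lookup⇒[]=)
open import Function.Base using (_∘_; _∘′_)
open import Induction.WellFounded using (Acc; acc)
open import Level using (0ℓ)
open import Relation.Binary.Core using (Rel)
open import Relation.Binary.Definitions using (tri<; tri≈; tri>) renaming (Decidable to Decidable₂)
open import Relation.Binary.PropositionalEquality
  using (_≡_; _≢_; refl; sym; trans; cong; cong₂; subst; subst₂; ≢-sym)
open import Relation.Nullary.Decidable using (Dec; yes; no; does; dec-true; dec-false; ¬?; _×-dec_)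
open import Relation.Nullary.Negation using (¬_; contradiction)
open import Relation.Unary using (Pred; Decidable)

private
  variable
    n : ℕ
    p q : Subset n
    x y : Fin n
    xs : List (Fin n)

filterˢ : {P : Pred (Fin n) 0ℓ} → Decidable P → Subset n
filterˢ P? = tabulate (does ∘ P?)

module _ {P : Pred (Fin n) 0ℓ} (P? : Decidable P) where

  ∈-filterˢ⁺ : P x → x ∈ filterˢ P?
  ∈-filterˢ⁺ {x} Px = lookup⇒[]= x _ (trans (lookup∘tabulate _ x) (dec-true (P? x) Px))

  ∈-filterˢ⁻ : x ∈ filterˢ P? → P x
  ∈-filterˢ⁻ {x} x∈ with P? x | trans (sym (lookup∘tabulate _ x)) ([]=⇒lookup x∈)
  ... | yes Px | _ = Px
  ... | no _   | ()

x∈p─q⇒x∉q : ∀ (p q : Subset n) → x ∈ p ─ q → x ∉ q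
x∈p─q⇒x∉q (_ ∷ p) (inside  ∷ q) (there x∈p─q) (there x∈q) = x∈p─q⇒x∉q p q x∈p─q x∈q
x∈p─q⇒x∉q (_ ∷ p) (outside ∷ q) (there x∈p─q) (there x∈q) = x∈p─q⇒x∉q p q x∈p─q x∈q

∣p∣≡∣p∩q∣+∣p─q∣ : ∀ (p q : Subset n) → ∣ p ∣ ≡ ∣ p ∩ q ∣ + ∣ p ─ q ∣
∣p∣≡∣p∩q∣+∣p─q∣ [] [] = refl
∣p∣≡∣p∩q∣+∣p─q∣ (outside ∷ p) (inside  ∷ q) = ∣p∣≡∣p∩q∣+∣p─q∣ p q
∣p∣≡∣p∩q∣+∣p─q∣ (outside ∷ p) (outside ∷ q) = ∣p∣≡∣p∩q∣+∣p─q∣ p q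
∣p∣≡∣p∩q∣+∣p─q∣ (inside ∷ p) (inside ∷ q) = cong suc (∣p∣≡∣p∩q∣+∣p─q∣ p q)
∣p∣≡∣p∩q∣+∣p─q∣ (inside ∷ p) (outside ∷ q) = trans (cong suc (∣p∣≡∣p∩q∣+∣p─q∣ p q)) (sym (+-suc _ _))

∣p∪q∣≤∣p∣+∣q∣ : ∀ (p q : Subset n) → ∣ p ∪ q ∣ ≤ ∣ p ∣ + ∣ q ∣
∣p∪q∣≤∣p∣+∣q∣ [] [] = z≤n
∣p∪q∣≤∣p∣+∣q∣ (outside ∷ p) (outside ∷ q) = ∣p∪q∣≤∣p∣+∣q∣ p q
∣p∪q∣≤∣p∣+∣q∣ (outside ∷ p) (inside ∷ q) =
  subst (suc ∣ p ∪ q ∣ ≤_) (sym (+-suc ∣ p ∣ ∣ q ∣)) (s≤s (∣p∪q∣≤∣p∣+∣q∣ p q))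
∣p∪q∣≤∣p∣+∣q∣ (inside ∷ p) (outside ∷ q) = s≤s (∣p∪q∣≤∣p∣+∣q∣ p q)
∣p∪q∣≤∣p∣+∣q∣ (inside ∷ p) (inside ∷ q) =
  s≤s (≤-trans (∣p∪q∣≤∣p∣+∣q∣ p q) (+-monoʳ-≤ ∣ p ∣ (n≤1+n ∣ q ∣)))

∣p∪q∣≡∣p∣+∣q∣ : ∀ (p q : Subset n) → (∀ {x} → x ∈ p → x ∉ q) → ∣ p ∪ q ∣ ≡ ∣ p ∣ + ∣ q ∣
∣p∪q∣≡∣p∣+∣q∣ [] [] _ = refl
∣p∪q∣≡∣p∣+∣q∣ (inside ∷ p) (inside ∷ q) disjoint = contradiction here (disjoint here)
∣p∪q∣≡∣p∣+∣q∣ (inside ∷ p) (outside ∷ q) disjoint =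
  cong suc (∣p∪q∣≡∣p∣+∣q∣ p q λ x∈p x∈q → disjoint (there x∈p) (there x∈q))
∣p∪q∣≡∣p∣+∣q∣ (outside ∷ p) (inside ∷ q) disjoint =
  trans (cong suc (∣p∪q∣≡∣p∣+∣q∣ p q λ x∈p x∈q → disjoint (there x∈p) (there x∈q))) (sym (+-suc _ _))
∣p∪q∣≡∣p∣+∣q∣ (outside ∷ p) (outside ∷ q) disjoint =
  ∣p∪q∣≡∣p∣+∣q∣ p q λ x∈p x∈q → disjoint (there x∈p) (there x∈q)

Empty⇒∣p∣≡0 : Empty p → ∣ p ∣ ≡ 0
Empty⇒∣p∣≡0 {n} empty = trans (cong ∣_∣ (Empty-unique empty)) (∣⊥∣≡0 n)

0<∣p∣⇒Nonempty : 0 < ∣ p ∣ → Nonempty p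
0<∣p∣⇒Nonempty {p = p} 0<∣p∣ with nonempty? p
... | yes nonempty = nonempty
... | no  empty    = contradiction (Empty⇒∣p∣≡0 empty) (>⇒≢ 0<∣p∣)

⁅x⁆⊆p : x ∈ p → ⁅ x ⁆ ⊆ p
⁅x⁆⊆p {x = x} {p = p} x∈p y∈⁅x⁆ = subst (_∈ p) (sym (x∈⁅y⁆⇒x≡y x y∈⁅x⁆)) x∈p

-- Hall's theorem

module Hall {n : ℕ} (R : Rel (Fin n) 0ℓ) (R? : Decidable₂ R) where

  NeighbourIn : Subset n → Subset n → Pred (Fin n) 0ℓ
  NeighbourIn Y Z z = z ∈ Z × ∃[ y ] y ∈ Y × R y z

  neighbourIn? : ∀ Y Z → Decidable (NeighbourIn Y Z)
  neighbourIn? Y Z z = (z ∈? Z) ×-dec any? λ y → (y ∈? Y) ×-dec R? y z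

  neighbours : Subset n → Subset n → Subset n
  neighbours Y Z = filterˢ (neighbourIn? Y Z)

  module _ {Y Z : Subset n} where

    ∈-neighbours⁺ : ∀ {y z} → z ∈ Z → y ∈ Y → R y z → z ∈ neighbours Y Z
    ∈-neighbours⁺ z∈Z y∈Y yRz = ∈-filterˢ⁺ (neighbourIn? Y Z) (z∈Z , _ , y∈Y , yRz)

    ∈-neighbours⁻ : ∀ {z} → z ∈ neighbours Y Z → NeighbourIn Y Z z
    ∈-neighbours⁻ = ∈-filterˢ⁻ (neighbourIn? Y Z)

    neighbours⊆ : neighbours Y Z ⊆ Z
    neighbours⊆ = proj₁ ∘ ∈-neighbours⁻

  record Matching (Y Z : Subset n) : Set where
    field
      match     : Fin n → Fin n
      match∈    : ∀ {y} → y ∈ Y → match y ∈ Z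
      related   : ∀ {y} → y ∈ Y → R y (match y)
      injective : ∀ {y y′} → y ∈ Y → y′ ∈ Y → match y ≡ match y′ → y ≡ y′

  HallCondition : Subset n → Subset n → Set
  HallCondition Y Z = ∀ Y′ → Y′ ⊆ Y → ∣ Y′ ∣ ≤ ∣ neighbours Y′ Z ∣

  Tight : Subset n → Subset n → Subset n → Set
  Tight Y Z Y′ = Y′ ⊂ Y × Nonempty Y′ × ∣ neighbours Y′ Z ∣ ≤ ∣ Y′ ∣

  empty-matching : ∀ {Y Z} → Empty Y → Matching Y Z
  empty-matching empty = record
    { match     = λ y → y
    ; match∈    = λ y∈Y → contradiction (_ , y∈Y) empty
    ; related   = λ y∈Y → contradiction (_ , y∈Y) empty
    ; injective = λ y∈Y _ _ → contradiction (_ , y∈Y) empty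
    }

  singleton-matching : ∀ {y z} → R y z → Matching ⁅ y ⁆ ⁅ z ⁆
  singleton-matching {y} {z} yRz = record
    { match     = λ _ → z
    ; match∈    = λ _ → x∈⁅x⁆ z
    ; related   = λ y′∈ → subst (λ y′ → R y′ z) (sym (x∈⁅y⁆⇒x≡y y y′∈)) yRz
    ; injective = λ y₁∈ y₂∈ _ → trans (x∈⁅y⁆⇒x≡y y y₁∈) (sym (x∈⁅y⁆⇒x≡y y y₂∈))
    }

  matching-neighbours : ∀ {Y Z} → Matching Y Z → Matching Y (neighbours Y Z)
  matching-neighbours M = record
    { match     = M.match
    ; match∈    = λ y∈Y → ∈-neighbours⁺ (M.match∈ y∈Y) y∈Y (M.related y∈Y)
    ; related   = M.related
    ; injective = M.injective
    }
    where module M = Matching M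

  matching-split : ∀ {Y Z Y₁ Z₁} → Z₁ ⊆ Z →
                   Matching Y₁ Z₁ → Matching (Y ─ Y₁) (Z ─ Z₁) → Matching Y Z
  matching-split {Y} {Z} {Y₁} {Z₁} Z₁⊆Z M₁ M₂ = record
    { match = λ y → choose y (y ∈? Y₁) ; match∈ = match∈ ; related = related ; injective = injective }
    where
    module M₁ = Matching M₁
    module M₂ = Matching M₂

    choose : ∀ y → Dec (y ∈ Y₁) → Fin n
    choose y (yes _) = M₁.match y
    choose y (no  _) = M₂.match y

    match∈ : ∀ {y} → y ∈ Y → choose y (y ∈? Y₁) ∈ Z
    match∈ {y} y∈Y with y ∈? Y₁
    ... | yes y∈Y₁ = Z₁⊆Z (M₁.match∈ y∈Y₁)
    ... | no  y∉Y₁ = p─q⊆p Z Z₁ (M₂.match∈ (x∈p∧x∉q⇒x∈p─q y∈Y y∉Y₁))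

    related : ∀ {y} → y ∈ Y → R y (choose y (y ∈? Y₁))
    related {y} y∈Y with y ∈? Y₁
    ... | yes y∈Y₁ = M₁.related y∈Y₁
    ... | no  y∉Y₁ = M₂.related (x∈p∧x∉q⇒x∈p─q y∈Y y∉Y₁)

    separated : ∀ {y y′} → y ∈ Y₁ → y′ ∈ Y → y′ ∉ Y₁ → M₁.match y ≢ M₂.match y′
    separated y∈Y₁ y′∈Y y′∉Y₁ eq =
      x∈p─q⇒x∉q Z Z₁ (M₂.match∈ (x∈p∧x∉q⇒x∈p─q y′∈Y y′∉Y₁)) (subst (_∈ Z₁) eq (M₁.match∈ y∈Y₁))

    injective : ∀ {y y′} → y ∈ Y → y′ ∈ Y → choose y (y ∈? Y₁) ≡ choose y′ (y′ ∈? Y₁) → y ≡ y′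
    injective {y} {y′} y∈Y y′∈Y eq with y ∈? Y₁ | y′ ∈? Y₁
    ... | yes y∈Y₁ | yes y′∈Y₁ = M₁.injective y∈Y₁ y′∈Y₁ eq
    ... | no  y∉Y₁ | no  y′∉Y₁ = M₂.injective (x∈p∧x∉q⇒x∈p─q y∈Y y∉Y₁) (x∈p∧x∉q⇒x∈p─q y′∈Y y′∉Y₁) eq
    ... | yes y∈Y₁ | no  y′∉Y₁ = contradiction eq (separated y∈Y₁ y′∈Y y′∉Y₁)
    ... | no  y∉Y₁ | yes y′∈Y₁ = contradiction (sym eq) (separated y′∈Y₁ y∈Y y∉Y₁)

  ∣neighbours-Z∣≤∣neighbours-Z─W∣+∣W∣ : ∀ Y Z W → ∣ neighbours Y Z ∣ ≤ ∣ neighbours Y (Z ─ W) ∣ + ∣ W ∣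
  ∣neighbours-Z∣≤∣neighbours-Z─W∣+∣W∣ Y Z W =
    ≤-trans (p⊆q⇒∣p∣≤∣q∣ cover) (∣p∪q∣≤∣p∣+∣q∣ (neighbours Y (Z ─ W)) W)
    where
    cover : neighbours Y Z ⊆ neighbours Y (Z ─ W) ∪ W
    cover {z} z∈ with ∈-neighbours⁻ z∈ | z ∈? W
    ... | _                   | yes z∈W = x∈p∪q⁺ (inj₂ z∈W)
    ... | z∈Z , _ , y∈Y , yRz | no  z∉W = x∈p∪q⁺ (inj₁ (∈-neighbours⁺ (x∈p∧x∉q⇒x∈p─q z∈Z z∉W) y∈Y yRz))

  HallCondition-without-tight : ∀ {Y Z Y′} → HallCondition Y Z → Y′ ⊆ Y → ∣ neighbours Y′ Z ∣ ≤ ∣ Y′ ∣ →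
                         HallCondition (Y ─ Y′) (Z ─ neighbours Y′ Z)
  HallCondition-without-tight {Y} {Z} {Y′} hall Y′⊆Y tight Y″ Y″⊆Y─Y′ = +-cancelʳ-≤ ∣ Y′ ∣ _ _ (begin
    ∣ Y″ ∣ + ∣ Y′ ∣                  ≡⟨ ∣p∪q∣≡∣p∣+∣q∣ Y″ Y′ (x∈p─q⇒x∉q Y Y′ ∘ Y″⊆Y─Y′) ⟨
    ∣ Y″ ∪ Y′ ∣                      ≤⟨ hall (Y″ ∪ Y′) Y″∪Y′⊆Y ⟩
    ∣ neighbours (Y″ ∪ Y′) Z ∣       ≤⟨ ∣neighbours-Z∣≤∣neighbours-Z─W∣+∣W∣ (Y″ ∪ Y′) Z N′ ⟩
    ∣ neighbours (Y″ ∪ Y′) Z─N′ ∣ + ∣ N′ ∣ ≤⟨ +-mono-≤ (p⊆q⇒∣p∣≤∣q∣ only-Y″) tight ⟩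
    ∣ neighbours Y″ Z─N′ ∣ + ∣ Y′ ∣  ∎)
    where
    open ≤-Reasoning
    N′ Z─N′ : Subset n
    N′   = neighbours Y′ Z
    Z─N′ = Z ─ N′

    Y″∪Y′⊆Y : Y″ ∪ Y′ ⊆ Y
    Y″∪Y′⊆Y = [ p─q⊆p Y Y′ ∘ Y″⊆Y─Y′ , Y′⊆Y ] ∘ x∈p∪q⁻ Y″ Y′

    only-Y″ : neighbours (Y″ ∪ Y′) Z─N′ ⊆ neighbours Y″ Z─N′
    only-Y″ z∈ with ∈-neighbours⁻ z∈
    ... | z∈Z─N′ , y , y∈Y″∪Y′ , yRz with x∈p∪q⁻ Y″ Y′ y∈Y″∪Y′
    ...   | inj₁ y∈Y″ = ∈-neighbours⁺ z∈Z─N′ y∈Y″ yRz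
    ...   | inj₂ y∈Y′ =
      contradiction (∈-neighbours⁺ (p─q⊆p Z N′ z∈Z─N′) y∈Y′ yRz) (x∈p─q⇒x∉q Z N′ z∈Z─N′)

  HallCondition-without-edge : ∀ {Y Z y} z → y ∈ Y →
    (∀ Y′ → Y′ ⊂ Y → Nonempty Y′ → ∣ Y′ ∣ < ∣ neighbours Y′ Z ∣) → HallCondition (Y - y) (Z - z)
  HallCondition-without-edge {Y} {Z} {y} z y∈Y surplus Y′ Y′⊆Y-y with nonempty? Y′
  ... | no  empty    = subst (_≤ ∣ neighbours Y′ (Z - z) ∣) (sym (Empty⇒∣p∣≡0 empty)) z≤n
  ... | yes nonempty = ≤-pred (begin-strict
    ∣ Y′ ∣                              <⟨ surplus Y′ Y′⊂Y nonempty ⟩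
    ∣ neighbours Y′ Z ∣                 ≤⟨ ∣neighbours-Z∣≤∣neighbours-Z─W∣+∣W∣ Y′ Z ⁅ z ⁆ ⟩
    ∣ neighbours Y′ (Z - z) ∣ + ∣ ⁅ z ⁆ ∣ ≡⟨ cong (∣ neighbours Y′ (Z - z) ∣ +_) (∣⁅x⁆∣≡1 z) ⟩
    ∣ neighbours Y′ (Z - z) ∣ + 1       ≡⟨ +-comm _ 1 ⟩
    suc ∣ neighbours Y′ (Z - z) ∣       ∎)
    where
    open ≤-Reasoning
    Y′⊂Y : Y′ ⊂ Y
    Y′⊂Y = p─q⊆p Y ⁅ y ⁆ ∘ Y′⊆Y-y , y , y∈Y , λ y∈Y′ → x∈p─q⇒x∉q Y ⁅ y ⁆ (Y′⊆Y-y y∈Y′) (x∈⁅x⁆ y)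

  HallCondition⇒neighbour : ∀ {Y Z y} → HallCondition Y Z → y ∈ Y → ∃[ z ] z ∈ Z × R y z
  HallCondition⇒neighbour {Y} {Z} {y} hall y∈Y
    with 0<∣p∣⇒Nonempty (subst (_≤ ∣ neighbours ⁅ y ⁆ Z ∣) (∣⁅x⁆∣≡1 y) (hall ⁅ y ⁆ (⁅x⁆⊆p y∈Y)))
  ... | z , z∈ with ∈-neighbours⁻ z∈
  ...   | z∈Z , y′ , y′∈⁅y⁆ , y′Rz = z , z∈Z , subst (λ y′ → R y′ z) (x∈⁅y⁆⇒x≡y y y′∈⁅y⁆) y′Rz

  -- Halmos–Vaughan: split off a tight proper subset if there is one, otherwise match any y to any
  -- neighbour of it.
  hall-acc : ∀ {Y Z} → Acc _<_ ∣ Y ∣ → HallCondition Y Z → Matching Y Z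
  hall-acc {Y} {Z} (acc rec) hall with nonempty? Y | anySubset? {P = Tight Y Z} (λ Y′ →
      (Y′ ⊂? Y) ×-dec nonempty? Y′ ×-dec (∣ neighbours Y′ Z ∣ ≤? ∣ Y′ ∣))
  ... | no  empty    | _ = empty-matching empty
  ... | yes (y , y∈Y) | yes (Y′ , Y′⊂Y@(Y′⊆Y , _) , (y′ , y′∈Y′) , tight) =
    matching-split (neighbours⊆ {Y′} {Z})
      (matching-neighbours (hall-acc (rec (p⊂q⇒∣p∣<∣q∣ Y′⊂Y)) λ Y″ Y″⊆Y′ → hall Y″ (Y′⊆Y ∘ Y″⊆Y′)))
      (hall-acc (rec (p∩q≢∅⇒∣p─q∣<∣p∣ Y Y′ (y′ , x∈p∩q⁺ (Y′⊆Y y′∈Y′ , y′∈Y′))))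
                (HallCondition-without-tight hall Y′⊆Y tight))
  ... | yes (y , y∈Y) | no  no-tight with HallCondition⇒neighbour hall y∈Y
  ...   | z , z∈Z , yRz =
    matching-split (⁅x⁆⊆p z∈Z) (singleton-matching yRz)
      (hall-acc (rec (x∈p⇒∣p-x∣<∣p∣ y∈Y)) (HallCondition-without-edge z y∈Y surplus))
    where
    surplus : ∀ Y′ → Y′ ⊂ Y → Nonempty Y′ → ∣ Y′ ∣ < ∣ neighbours Y′ Z ∣
    surplus Y′ Y′⊂Y nonempty = ≰⇒> λ tight → no-tight (Y′ , Y′⊂Y , nonempty , tight)

  hall : ∀ {Y Z} → HallCondition Y Z → Matching Y Z
  hall = hall-acc (<-wellFounded _)

  ¬Matching⇒deficient-subset : ∀ {Y Z} → ¬ Matching Y Z → ∃[ Y′ ] Y′ ⊆ Y × ∣ neighbours Y′ Z ∣ < ∣ Y′ ∣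
  ¬Matching⇒deficient-subset {Y} {Z} ¬matching
    with anySubset? (λ Y′ → (Y′ ⊆? Y) ×-dec (∣ neighbours Y′ Z ∣ <? ∣ Y′ ∣))
  ... | yes violator = violator
  ... | no  none     = contradiction (hall λ Y′ Y′⊆Y → ≮⇒≥ λ lt → none (Y′ , Y′⊆Y , lt)) ¬matching

-- Circuits, and cycles of length divisible by 4

All-lastOr : {P : Pred (Fin n) 0ℓ} → All P (x ∷ xs) → P (lastOr x xs)
All-lastOr (Px ∷ [])        = Px
All-lastOr (_ ∷ Px′ ∷ Pxs) = All-lastOr (Px′ ∷ Pxs)

Linked-∷ʳ : {S : Rel (Fin n) 0ℓ} → Linked S (x ∷ xs) → S (lastOr x xs) y → Linked S (x ∷ xs ∷ʳ y)
Linked-∷ʳ [-]       s = s ∷ [-]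
Linked-∷ʳ (r ∷ rs) s = r ∷ Linked-∷ʳ rs s

Unique-∷ʳ : Unique xs → y ∉ₗ xs → Unique (xs ∷ʳ y)
Unique-∷ʳ u y∉xs = Unique.++⁺ u ([] ∷ []) λ where (y∈xs , here refl) → y∉xs y∈xs

record Circuit {n} (P : Pred (Fin n) 0ℓ) (S : Rel (Fin n) 0ℓ) : Set where
  constructor circuit
  field
    start  : Fin n
    rest   : List (Fin n)
    unique : Unique (start ∷ rest)
    all    : All P (start ∷ rest)
    linked : Linked S (start ∷ rest)
    closed : S (lastOr start rest) start

module _ {n} {P : Pred (Fin n) 0ℓ} {S : Rel (Fin n) 0ℓ}
         (successor : ∀ {x} → P x → ∃[ y ] P y × S x y) where

  open import Data.List.Membership.DecPropositional (Fin._≟_ {n}) using () renaming (_∈?_ to _∈ₗ?_)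

  private
    close-at : ∀ {x xs y} → y ∈ₗ x ∷ xs → Unique (x ∷ xs) → All P (x ∷ xs) → Linked S (x ∷ xs) →
               S (lastOr x xs) y → Circuit P S
    close-at {x} {xs} (here refl) u a l s = circuit x xs u a l s
    close-at {xs = _ ∷ _} (there y∈) (_ ∷ u) (_ ∷ a) (_ ∷ l) s = close-at y∈ u a l s

    -- U contains every vertex off the path and loses a vertex at each step, which bounds the search.
    extend : ∀ {x xs} (U : Subset n) → Acc _<_ ∣ U ∣ → (∀ {y} → y ∉ₗ x ∷ xs → y ∈ U) →
             Unique (x ∷ xs) → All P (x ∷ xs) → Linked S (x ∷ xs) → Circuit P S
    extend {x} {xs} U (acc rec) unvisited u a l with successor (All-lastOr a)
    ... | y , Py , s with y ∈ₗ? x ∷ xs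
    ...   | yes y∈ = close-at y∈ u a l s
    ...   | no  y∉ = extend (U - y) (rec (x∈p⇒∣p-x∣<∣p∣ (unvisited y∉))) unvisited′
                       (Unique-∷ʳ u y∉) (All.++⁺ a (Py ∷ [])) (Linked-∷ʳ l s)
      where
      unvisited′ : ∀ {v} → v ∉ₗ x ∷ xs ∷ʳ y → v ∈ U - y
      unvisited′ v∉ =
        x∈p∧x≢y⇒x∈p-y (unvisited (v∉ ∘′ ∈-++⁺ˡ)) λ where refl → v∉ (∈-++⁺ʳ (x ∷ xs) (here refl))

  circuit-from : ∀ {x} → P x → Circuit P S
  circuit-from Px = extend full (<-wellFounded _) (λ _ → ∈⊤) ([] ∷ []) (Px ∷ []) [-]

module _ {n} (s : Fin n → Bool) where

  Alternates : Rel (Fin n) 0ℓ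
  Alternates x y = s y ≡ not (s x)

  closed-alternating-walk-even : Linked Alternates (x ∷ xs) → Alternates (lastOr x xs) x →
                                 2 ∣ length (x ∷ xs)
  closed-alternating-walk-even [-]       back = contradiction back (Bool.not-¬ refl)
  closed-alternating-walk-even (_ ∷ [-]) _    = ∣-refl
  closed-alternating-walk-even {x} {_ ∷ x″ ∷ _} (alt₁ ∷ alt₂ ∷ alts) back =
    ∣m∣n⇒∣m+n (∣-refl {2}) (closed-alternating-walk-even alts (trans same-sign back))
    where
    same-sign : s x″ ≡ s x
    same-sign = trans alt₂ (trans (cong not alt₁) (Bool.not-involutive _))

module Zigzag {n} (G : Graph n) {P : Pred (Fin n) 0ℓ} (m : Fin n → Fin n)
  (adjacent-m : ∀ {y} → P y → Adjacent G y (m y))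
  (m-injective : ∀ {y y′} → P y → P y′ → m y ≡ m y′ → y ≡ y′)
  (m-disjoint : ∀ {y y′} → P y → P y′ → y ≢ m y′)
  (s : Fin n → Bool) where

  Step : Rel (Fin n) 0ℓ
  Step y y′ = Adjacent G (m y) y′ × Alternates s y y′

  zigzag : List (Fin n) → List (Fin n)
  zigzag []       = []
  zigzag (y ∷ ys) = y ∷ m y ∷ zigzag ys

  length-zigzag : ∀ ys → length (zigzag ys) ≡ 2 * length ys
  length-zigzag []       = refl
  length-zigzag (y ∷ ys) = trans (cong (suc ∘′ suc) (length-zigzag ys)) (sym (*-suc 2 (length ys)))

  ∈-zigzag⁻ : ∀ {v} ys → v ∈ₗ zigzag ys → v ∈ₗ ys ⊎ ∃[ y ] y ∈ₗ ys × v ≡ m y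
  ∈-zigzag⁻ (y ∷ ys) (here v≡y)          = inj₁ (here v≡y)
  ∈-zigzag⁻ (y ∷ ys) (there (here v≡my)) = inj₂ (y , here refl , v≡my)
  ∈-zigzag⁻ (y ∷ ys) (there (there v∈))  with ∈-zigzag⁻ ys v∈
  ... | inj₁ v∈ys              = inj₁ (there v∈ys)
  ... | inj₂ (y′ , y′∈ys , eq) = inj₂ (y′ , there y′∈ys , eq)

  unique-zigzag : ∀ {ys} → All P ys → Unique ys → Unique (zigzag ys)
  unique-zigzag [] [] = []
  unique-zigzag {y ∷ ys} (Py ∷ Pys) (y∉ys ∷ u) =
    (m-disjoint Py Py ∷ All.tabulate y-fresh) ∷ All.tabulate my-fresh ∷ unique-zigzag Pys u
    where
    y-fresh : ∀ {v} → v ∈ₗ zigzag ys → y ≢ v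
    y-fresh v∈ with ∈-zigzag⁻ ys v∈
    ... | inj₁ v∈ys              = All.lookup y∉ys v∈ys
    ... | inj₂ (y′ , y′∈ys , refl) = m-disjoint Py (All.lookup Pys y′∈ys)
    my-fresh : ∀ {v} → v ∈ₗ zigzag ys → m y ≢ v
    my-fresh v∈ my≡v with ∈-zigzag⁻ ys v∈
    ... | inj₁ v∈ys              = m-disjoint (All.lookup Pys v∈ys) Py (sym my≡v)
    ... | inj₂ (y′ , y′∈ys , refl) =
      All.lookup y∉ys y′∈ys (m-injective Py (All.lookup Pys y′∈ys) my≡v)

  walk-zigzag : All P (x ∷ xs) → Linked Step (x ∷ xs) → IsWalk G (zigzag (x ∷ xs))
  walk-zigzag (Px ∷ [])  [-]            = adjacent-m Px , _
  walk-zigzag (Px ∷ Pxs) (step ∷ steps) = adjacent-m Px , proj₁ step , walk-zigzag Pxs steps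

  lastOr-zigzag : ∀ x xs → lastOr x (m x ∷ zigzag xs) ≡ m (lastOr x xs)
  lastOr-zigzag x []        = refl
  lastOr-zigzag x (x′ ∷ xs) = lastOr-zigzag x′ xs

  C4kFree⇒¬Circuit : IsC4kFree G → ¬ Circuit P Step
  C4kFree⇒¬Circuit C4k-free (circuit x xs unique all linked closed) =
    C4k-free (zigzag (x ∷ xs)) is-cycle (subst (4 ∣_) (sym length≡) (*-monoʳ-∣ 2 even))
    where
    even : 2 ∣ length (x ∷ xs)
    even = closed-alternating-walk-even s (Linked.map proj₂ linked) (proj₂ closed)
    length≡ : length (zigzag (x ∷ xs)) ≡ 2 * length (x ∷ xs)
    length≡ = length-zigzag (x ∷ xs)
    is-cycle : IsCycle G (zigzag (x ∷ xs))
    is-cycle = subst (3 ≤_) (sym length≡) (≤-trans (n≤1+n 3) (*-monoʳ-≤ 2 (∣⇒≤ even))) ,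
               unique-zigzag all unique ,
               walk-zigzag all linked ,
               subst (λ v → Adjacent G v x) (sym (lastOr-zigzag x xs)) (proj₁ closed)

-- Null vectors

sumℚ-cong : {f g : Fin n → ℚ} → (∀ j → f j ≡ g j) → sumℚ f ≡ sumℚ g
sumℚ-cong {n = zero}  _   = refl
sumℚ-cong {n = suc n} f≗g = cong₂ ℚ._+_ (f≗g zero) (sumℚ-cong (f≗g ∘ suc))

sumℚ-zero : {f : Fin n → ℚ} → (∀ j → f j ≡ 0ℚ) → sumℚ f ≡ 0ℚ
sumℚ-zero {n = zero}  _   = refl
sumℚ-zero {n = suc n} f≡0 = cong₂ ℚ._+_ (f≡0 zero) (sumℚ-zero (f≡0 ∘ suc))

sumℚ-nonneg : {g : Fin n → ℚ} → (∀ j → 0ℚ ℚ.≤ g j) → 0ℚ ℚ.≤ sumℚ g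
sumℚ-nonneg {n = zero}  _   = ℚ.≤-refl
sumℚ-nonneg {n = suc n} g≥0 = ℚ.+-mono-≤ (g≥0 zero) (sumℚ-nonneg (g≥0 ∘ suc))

sumℚ-nonpos : {g : Fin n → ℚ} → (∀ j → g j ℚ.≤ 0ℚ) → sumℚ g ℚ.≤ 0ℚ
sumℚ-nonpos {n = zero}  _   = ℚ.≤-refl
sumℚ-nonpos {n = suc n} g≤0 = ℚ.+-mono-≤ (g≤0 zero) (sumℚ-nonpos (g≤0 ∘ suc))

term≤sumℚ : (g : Fin n → ℚ) → (∀ j → 0ℚ ℚ.≤ g j) → ∀ i → g i ℚ.≤ sumℚ g
term≤sumℚ g g≥0 zero    = subst (ℚ._≤ sumℚ g) (ℚ.+-identityʳ (g zero))
  (ℚ.+-monoʳ-≤ (g zero) (sumℚ-nonneg (g≥0 ∘ suc)))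
term≤sumℚ g g≥0 (suc i) = subst (ℚ._≤ sumℚ g) (ℚ.+-identityˡ (g (suc i)))
  (ℚ.+-mono-≤ (g≥0 zero) (term≤sumℚ (g ∘ suc) (g≥0 ∘ suc) i))

sumℚ≤term : (g : Fin n → ℚ) → (∀ j → g j ℚ.≤ 0ℚ) → ∀ i → sumℚ g ℚ.≤ g i
sumℚ≤term g g≤0 zero    = subst (sumℚ g ℚ.≤_) (ℚ.+-identityʳ (g zero))
  (ℚ.+-monoʳ-≤ (g zero) (sumℚ-nonpos (g≤0 ∘ suc)))
sumℚ≤term g g≤0 (suc i) = subst (sumℚ g ℚ.≤_) (ℚ.+-identityˡ (g (suc i)))
  (ℚ.+-mono-≤ (g≤0 zero) (sumℚ≤term (g ∘ suc) (g≤0 ∘ suc) i))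

positiveᵇ : ℚ → Bool
positiveᵇ q = does (0ℚ ℚ.<? q)

positiveᵇ-true : ∀ {q} → 0ℚ ℚ.< q → positiveᵇ q ≡ true
positiveᵇ-true {q} = dec-true (0ℚ ℚ.<? q)

positiveᵇ-false : ∀ {q} → q ℚ.< 0ℚ → positiveᵇ q ≡ false
positiveᵇ-false {q} = dec-false (0ℚ ℚ.<? q) ∘ ℚ.<-asym

zero-sum⇒opposite-sign : (g : Fin n → ℚ) → sumℚ g ≡ 0ℚ → ∀ i → g i ≢ 0ℚ →
                         ∃[ j ] g j ≢ 0ℚ × positiveᵇ (g j) ≡ not (positiveᵇ (g i))
zero-sum⇒opposite-sign g Σg≡0 i gi≢0 with ℚ.<-cmp 0ℚ (g i)
... | tri≈ _ 0≡gi _ = contradiction (sym 0≡gi) gi≢0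
... | tri< 0<gi _ _ with any? (λ j → g j ℚ.<? 0ℚ)
...   | yes (j , gj<0) =
  j , ℚ.<⇒≢ gj<0 , trans (positiveᵇ-false gj<0) (cong not (sym (positiveᵇ-true 0<gi)))
...   | no  none       = contradiction (ℚ.<-≤-trans 0<gi (subst (g i ℚ.≤_) Σg≡0 gi≤Σg)) (ℚ.<-irrefl refl)
  where
  gi≤Σg : g i ℚ.≤ sumℚ g
  gi≤Σg = term≤sumℚ g (λ j → ℚ.≮⇒≥ (none ∘ (j ,_))) i
zero-sum⇒opposite-sign g Σg≡0 i gi≢0 | tri> _ _ gi<0 with any? (λ j → 0ℚ ℚ.<? g j)
...   | yes (j , 0<gj) =
  j , ≢-sym (ℚ.<⇒≢ 0<gj) , trans (positiveᵇ-true 0<gj) (cong not (sym (positiveᵇ-false gi<0)))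
...   | no  none       = contradiction (ℚ.≤-<-trans (subst (ℚ._≤ g i) Σg≡0 Σg≤gi) gi<0) (ℚ.<-irrefl refl)
  where
  Σg≤gi : sumℚ g ℚ.≤ g i
  Σg≤gi = sumℚ≤term g (λ j → ℚ.≮⇒≥ (none ∘ (j ,_))) i

rowTerm : Graph n → (Fin n → ℚ) → Fin n → Fin n → ℚ
rowTerm G x i j = if adj G i j then x j else 0ℚ

rowTerm-adjacent : ∀ (G : Graph n) x {i j} → Adjacent G i j → rowTerm G x i j ≡ x j
rowTerm-adjacent G x = Bool.if-cong

rowTerm≢0⇒adjacent : ∀ (G : Graph n) x {i j} → rowTerm G x i j ≢ 0ℚ → Adjacent G i j
rowTerm≢0⇒adjacent G x {i} {j} t≢0 with adj G i j
... | true  = refl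
... | false = contradiction refl t≢0

restrict : (Fin n → Bool) → Bool → (Fin n → ℚ) → Fin n → ℚ
restrict c b x j = if does (c j Bool.≟ b) then x j else 0ℚ

restrict-inside : ∀ (c : Fin n → Bool) {b} x {j} → c j ≡ b → restrict c b x j ≡ x j
restrict-inside c x {j} cj≡b = Bool.if-cong (dec-true (c j Bool.≟ _) cj≡b)

restrict-outside : ∀ (c : Fin n → Bool) {b} x {j} → c j ≢ b → restrict c b x j ≡ 0ℚ
restrict-outside c x {j} cj≢b = Bool.if-cong (dec-false (c j Bool.≟ _) cj≢b)

restrict-support : ∀ (c : Fin n → Bool) {b} x {j} → restrict c b x j ≢ 0ℚ → c j ≡ b
restrict-support c {b} x {j} r≢0 with c j Bool.≟ b
... | yes cj≡b = cj≡b
... | no  _    = contradiction refl r≢0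

adjacent-sym : ∀ (G : Graph n) {u v} → Adjacent G u v → Adjacent G v u
adjacent-sym G {u} {v} u~v = trans (Graph.sym G v u) u~v

adjacent? : (G : Graph n) → ∀ u v → Dec (Adjacent G u v)
adjacent? G u v = adj G u v Bool.≟ true

module _ (G : Graph n) where

  open Hall (Adjacent G) (adjacent? G)

  restrict-null : ∀ (c : Fin n → Bool) → (∀ u v → Adjacent G u v → c u ≢ c v) →
                  ∀ {x} → InNull G x → ∀ b → InNull G (restrict c b x)
  restrict-null c proper {x} null b i with c i Bool.≟ b
  ... | yes ci≡b = sumℚ-zero vanishes
    where
    vanishes : ∀ j → rowTerm G (restrict c b x) i j ≡ 0ℚ
    vanishes j with adj G i j in i~j
    ... | false = refl
    ... | true  = restrict-outside c x λ cj≡b → proper i j i~j (trans ci≡b (sym cj≡b))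
  ... | no  ci≢b = trans (sumℚ-cong unchanged) (null i)
    where
    unchanged : ∀ j → rowTerm G (restrict c b x) i j ≡ rowTerm G x i j
    unchanged j with adj G i j in i~j
    ... | false = refl
    ... | true  = restrict-inside c x
                    (trans (Bool.¬-not (≢-sym (proper i j i~j))) (sym (Bool.¬-not (≢-sym ci≢b))))

  null-vanishes-on-matched : IsC4kFree G → ∀ {Y Z} → (∀ {y} → y ∈ Y → y ∉ Z) → Matching Y Z →
    ∀ {x} → InNull G x → (∀ {z j} → z ∈ Z → Adjacent G z j → x j ≢ 0ℚ → j ∈ Y) →
    ∀ {y} → y ∈ Y → x y ≡ 0ℚ
  null-vanishes-on-matched C4k-free {Y} {Z} Y∉Z M {x} null support⊆Y {y₀} y₀∈Y with x y₀ ℚ.≟ 0ℚ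
  ... | yes xy₀≡0 = xy₀≡0
  ... | no  xy₀≢0 = ⊥-elim (C4kFree⇒¬Circuit C4k-free (circuit-from successor (y₀∈Y , xy₀≢0)))
    where
    open Matching M

    Nonzero : Pred (Fin n) 0ℓ
    Nonzero y = y ∈ Y × x y ≢ 0ℚ

    open Zigzag G match (related ∘ proj₁) (λ Py Py′ → injective (proj₁ Py) (proj₁ Py′))
      (λ Py Py′ y≡m → Y∉Z (proj₁ Py) (subst (_∈ Z) (sym y≡m) (match∈ (proj₁ Py′))))
      (positiveᵇ ∘ x)

    match~ : ∀ {y} → y ∈ Y → Adjacent G (match y) y
    match~ y∈Y = adjacent-sym G (related y∈Y)

    successor : ∀ {y} → Nonzero y → ∃[ j ] Nonzero j × Step y j
    successor {y} (y∈Y , xy≢0)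
      with zero-sum⇒opposite-sign (rowTerm G x (match y)) (null (match y)) y
             (subst (_≢ 0ℚ) (sym (rowTerm-adjacent G x (match~ y∈Y))) xy≢0)
    ... | j , term≢0 , sign = j , (support⊆Y (match∈ y∈Y) my~j xj≢0 , xj≢0) , my~j ,
      subst₂ (λ a b → positiveᵇ a ≡ not (positiveᵇ b))
             (rowTerm-adjacent G x my~j) (rowTerm-adjacent G x (match~ y∈Y)) sign
      where
      my~j : Adjacent G (match y) j
      my~j = rowTerm≢0⇒adjacent G x term≢0
      xj≢0 : x j ≢ 0ℚ
      xj≢0 = subst (_≢ 0ℚ) (rowTerm-adjacent G x my~j) term≢0

-- Supp, Core and maximum independent sets

module _ (G : Graph n) where

  open Hall (Adjacent G) (adjacent? G)

  Independent : Subset n → Set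
  Independent J = ∀ u v → u ∈ J → v ∈ J → ¬ Adjacent G u v

  ∪-independent : ∀ {A B} → Independent A → Independent B →
                  (∀ u v → u ∈ A → v ∈ B → ¬ Adjacent G u v) → Independent (A ∪ B)
  ∪-independent {A} {B} indA indB no-edge u v u∈ v∈ with x∈p∪q⁻ A B u∈ | x∈p∪q⁻ A B v∈
  ... | inj₁ u∈A | inj₁ v∈A = indA u v u∈A v∈A
  ... | inj₂ u∈B | inj₂ v∈B = indB u v u∈B v∈B
  ... | inj₁ u∈A | inj₂ v∈B = no-edge u v u∈A v∈B
  ... | inj₂ u∈B | inj₁ v∈A = no-edge v u v∈A u∈B ∘ adjacent-sym G

  module _ {I : Subset n} (maximum : IsMaxIndepIn G (λ _ → ⊤) I) where

    private
      indI : Independent I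
      indI = proj₂ (proj₁ maximum)

    maximum-exchange : ∀ {K A} → Independent K → (∀ {v} → v ∈ K → v ∉ I ─ A) →
                       (∀ u v → u ∈ K → v ∈ I ─ A → ¬ Adjacent G u v) → ∣ K ∣ ≤ ∣ A ∣
    maximum-exchange {K} {A} indK disjoint no-edge = +-cancelʳ-≤ ∣ I ─ A ∣ _ _ (begin
      ∣ K ∣ + ∣ I ─ A ∣       ≡⟨ ∣p∪q∣≡∣p∣+∣q∣ K (I ─ A) disjoint ⟨
      ∣ K ∪ (I ─ A) ∣         ≤⟨ proj₂ maximum (K ∪ (I ─ A)) ((λ _ _ → tt) , independent) ⟩
      ∣ I ∣                   ≡⟨ ∣p∣≡∣p∩q∣+∣p─q∣ I A ⟩
      ∣ I ∩ A ∣ + ∣ I ─ A ∣   ≤⟨ +-monoˡ-≤ ∣ I ─ A ∣ (∣p∩q∣≤∣q∣ I A) ⟩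
      ∣ A ∣ + ∣ I ─ A ∣       ∎)
      where
      open ≤-Reasoning
      independent : Independent (K ∪ (I ─ A))
      independent = ∪-independent indK (λ u v u∈ v∈ → indI u v (p─q⊆p I A u∈) (p─q⊆p I A v∈)) no-edge

    maximum⇒HallCondition : ∀ {Y} → Independent Y → (∀ {y} → y ∈ Y → y ∉ I) →
                            HallCondition Y (neighbours Y I)
    maximum⇒HallCondition {Y} indY Y∉I Y′ Y′⊆Y =
      ≤-trans (maximum-exchange indY′ disjoint no-edge) (p⊆q⇒∣p∣≤∣q∣ N⊆)
      where
      N : Subset n
      N = neighbours Y′ I
      indY′ : Independent Y′
      indY′ u v u∈ v∈ = indY u v (Y′⊆Y u∈) (Y′⊆Y v∈)
      disjoint : ∀ {v} → v ∈ Y′ → v ∉ I ─ N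
      disjoint v∈Y′ v∈I─N = Y∉I (Y′⊆Y v∈Y′) (p─q⊆p I N v∈I─N)
      no-edge : ∀ u v → u ∈ Y′ → v ∈ I ─ N → ¬ Adjacent G u v
      no-edge u v u∈Y′ v∈I─N u~v = x∈p─q⇒x∉q I N v∈I─N (∈-neighbours⁺ (p─q⊆p I N v∈I─N) u∈Y′ u~v)
      N⊆ : N ⊆ neighbours Y′ (neighbours Y I)
      N⊆ t∈N with ∈-neighbours⁻ t∈N
      ... | t∈I , y , y∈Y′ , y~t = ∈-neighbours⁺ (∈-neighbours⁺ t∈I (Y′⊆Y y∈Y′) y~t) y∈Y′ y~t

    Supp⊆maximum : IsBipartite G → IsC4kFree G → ∀ {v} → Supp G v → v ∈ I
    Supp⊆maximum (c , proper) C4k-free {v} (x , null , xv≢0) with v ∈? I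
    ... | yes v∈I = v∈I
    ... | no  v∉I = contradiction (trans (sym x′v≡xv) x′v≡0) xv≢0
      where
      -- Restricting x to the colour class of v keeps it null and makes its support independent.
      x′ : Fin n → ℚ
      x′ = restrict c (c v) x
      x′v≡xv : x′ v ≡ x v
      x′v≡xv = restrict-inside c x refl

      outside? : Decidable λ s → s ∉ I × x′ s ≢ 0ℚ
      outside? s = ¬? (s ∈? I) ×-dec ¬? (x′ s ℚ.≟ 0ℚ)
      Y : Subset n
      Y = filterˢ outside?

      colour-v : ∀ {y} → y ∈ Y → c y ≡ c v
      colour-v y∈Y = restrict-support c x (proj₂ (∈-filterˢ⁻ outside? y∈Y))

      indY : Independent Y
      indY u w u∈Y w∈Y u~w = proper u w u~w (trans (colour-v u∈Y) (sym (colour-v w∈Y)))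

      support-in-Y : ∀ {z j} → z ∈ neighbours Y I → Adjacent G z j → x′ j ≢ 0ℚ → j ∈ Y
      support-in-Y z∈ z~j x′j≢0 =
        ∈-filterˢ⁺ outside? ((λ j∈I → indI _ _ (neighbours⊆ z∈) j∈I z~j) , x′j≢0)

      x′v≡0 : x′ v ≡ 0ℚ
      x′v≡0 = null-vanishes-on-matched G C4k-free
        (λ y∈Y y∈N → proj₁ (∈-filterˢ⁻ outside? y∈Y) (neighbours⊆ y∈N))
        (hall (maximum⇒HallCondition indY (proj₁ ∘ ∈-filterˢ⁻ outside?)))
        (restrict-null G c proper null (c v)) support-in-Y
        (∈-filterˢ⁺ outside? (v∉I , λ x′v≡0 → xv≢0 (trans (sym x′v≡xv) x′v≡0)))

    Core∉maximum : (∀ {v} → Supp G v → v ∈ I) → ∀ {v} → Core G v → v ∉ I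
    Core∉maximum Supp⊆I (s , v~s , supp-s) v∈I = indI _ s v∈I (Supp⊆I supp-s) v~s

    Npart-maximum : (∀ {v} → Supp G v → v ∈ I) → ∀ {J} → IsInterWith I (Npart G) J →
                    IsMaxIndepIn G (Npart G) J
    Npart-maximum Supp⊆I {J} J≡I∩Npart =
      ((λ v v∈J → proj₂ (J⊆ v∈J)) , λ u v u∈J v∈J → indI u v (proj₁ (J⊆ u∈J)) (proj₁ (J⊆ v∈J))) ,
      λ K (K⊆Npart , indK) → maximum-exchange indK (disjoint K⊆Npart) (no-edge K⊆Npart)
      where
      J⊆ : ∀ {v} → v ∈ J → v ∈ I × Npart G v
      J⊆ = proj₁ (J≡I∩Npart _)
      disjoint : ∀ {K} → (∀ v → v ∈ K → Npart G v) → ∀ {v} → v ∈ K → v ∉ I ─ J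
      disjoint K⊆Npart v∈K v∈I─J =
        x∈p─q⇒x∉q I J v∈I─J (proj₂ (J≡I∩Npart _) (p─q⊆p I J v∈I─J , K⊆Npart _ v∈K))
      no-edge : ∀ {K} → (∀ v → v ∈ K → Npart G v) → ∀ u v → u ∈ K → v ∈ I ─ J → ¬ Adjacent G u v
      no-edge K⊆Npart u v u∈K v∈I─J u~v = x∈p─q⇒x∉q I J v∈I─J (proj₂ (J≡I∩Npart _) (v∈I , v-Npart))
        where
        v∈I : v ∈ I
        v∈I = p─q⊆p I J v∈I─J
        v-Npart : Npart G v
        v-Npart = (λ supp-v → proj₂ (K⊆Npart u u∈K) (v , u~v , supp-v)) ,
                  (λ core-v → Core∉maximum Supp⊆I core-v v∈I)

  surplus⇒∣K∣≤∣J∣ : ∀ {K J} → Independent K → ∣ K ─ J ∣ ≤ ∣ neighbours (K ─ J) J ∣ → ∣ K ∣ ≤ ∣ J ∣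
  surplus⇒∣K∣≤∣J∣ {K} {J} indK surplus = begin
    ∣ K ∣                  ≡⟨ ∣p∣≡∣p∩q∣+∣p─q∣ K J ⟩
    ∣ K ∩ J ∣ + ∣ K ─ J ∣  ≤⟨ +-mono-≤ (p⊆q⇒∣p∣≤∣q∣ K∩J⊆J─W) (≤-trans surplus (p⊆q⇒∣p∣≤∣q∣ W⊆J∩W)) ⟩
    ∣ J ─ W ∣ + ∣ J ∩ W ∣  ≡⟨ +-comm ∣ J ─ W ∣ ∣ J ∩ W ∣ ⟩
    ∣ J ∩ W ∣ + ∣ J ─ W ∣  ≡⟨ ∣p∣≡∣p∩q∣+∣p─q∣ J W ⟨
    ∣ J ∣                  ∎
    where
    open ≤-Reasoning
    W : Subset n
    W = neighbours (K ─ J) J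
    W⊆J∩W : W ⊆ J ∩ W
    W⊆J∩W t∈W = x∈p∩q⁺ (neighbours⊆ t∈W , t∈W)
    K∩J⊆J─W : K ∩ J ⊆ J ─ W
    K∩J⊆J─W {t} t∈K∩J = x∈p∧x∉q⇒x∈p─q t∈J t∉W
      where
      t∈K : t ∈ K
      t∈K = proj₁ (x∈p∩q⁻ K J t∈K∩J)
      t∈J : t ∈ J
      t∈J = proj₂ (x∈p∩q⁻ K J t∈K∩J)
      t∉W : t ∉ W
      t∉W t∈W with ∈-neighbours⁻ t∈W
      ... | _ , y , y∈K─J , y~t = indK y t (p─q⊆p K J y∈K─J) t∈K y~t

  module _ (C4k-free : IsC4kFree G) {J : Subset n} (Supp⊆J : ∀ {v} → Supp G v → v ∈ J) where

    CoreOutside : Subset n → Set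
    CoreOutside X = ∀ {v} → v ∈ X → Core G v × v ∉ J

    ¬Matching-into-Core : ∀ {X} → CoreOutside X → Nonempty X → ¬ Matching (neighbours X J) X
    ¬Matching-into-Core {X} X-core (x₀ , x₀∈X) M with proj₁ (X-core x₀∈X)
    ... | s , x₀~s , z , null , zs≢0 =
      zs≢0 (null-vanishes-on-matched G C4k-free W∉X M null support-in-W s∈W)
      where
      s∈W : s ∈ neighbours X J
      s∈W = ∈-neighbours⁺ (Supp⊆J (z , null , zs≢0)) x₀∈X x₀~s
      W∉X : ∀ {w} → w ∈ neighbours X J → w ∉ X
      W∉X w∈W w∈X = proj₂ (X-core w∈X) (neighbours⊆ w∈W)
      support-in-W : ∀ {t j} → t ∈ X → Adjacent G t j → z j ≢ 0ℚ → j ∈ neighbours X J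
      support-in-W t∈X t~j zj≢0 = ∈-neighbours⁺ (Supp⊆J (z , null , zj≢0)) t∈X t~j

    -- By Hall's theorem N(X) ∩ J has a deficient part W′, and the J-neighbours of X ─ N(W′) lie in
    -- (N(X) ∩ J) ─ W′, so induction applies to X ─ N(W′).
    Core-surplus-acc : ∀ {X} → Acc _<_ ∣ neighbours X J ∣ → CoreOutside X → ∣ X ∣ ≤ ∣ neighbours X J ∣
    Core-surplus-acc {X} (acc rec) X-core with nonempty? X
    ... | no  empty    = subst (_≤ ∣ neighbours X J ∣) (sym (Empty⇒∣p∣≡0 empty)) z≤n
    ... | yes nonempty with ¬Matching⇒deficient-subset (¬Matching-into-Core X-core nonempty)
    ...   | W′ , W′⊆W , deficient = begin
      ∣ X ∣                    ≡⟨ ∣p∣≡∣p∩q∣+∣p─q∣ X N′ ⟩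
      ∣ X ∩ N′ ∣ + ∣ X″ ∣      ≤⟨ +-mono-≤ ∣X∩N′∣≤∣W′∣ (≤-trans IH ∣N[X″]∣≤) ⟩
      ∣ W′ ∣ + ∣ W ─ W′ ∣      ≤⟨ +-monoˡ-≤ ∣ W ─ W′ ∣ (p⊆q⇒∣p∣≤∣q∣ W′⊆W∩W′) ⟩
      ∣ W ∩ W′ ∣ + ∣ W ─ W′ ∣  ≡⟨ ∣p∣≡∣p∩q∣+∣p─q∣ W W′ ⟨
      ∣ W ∣                    ∎
      where
      open ≤-Reasoning
      W N′ X″ : Subset n
      W  = neighbours X J
      N′ = neighbours W′ X
      X″ = X ─ N′

      ∣X∩N′∣≤∣W′∣ : ∣ X ∩ N′ ∣ ≤ ∣ W′ ∣
      ∣X∩N′∣≤∣W′∣ = ≤-trans (∣p∩q∣≤∣q∣ X N′) (<⇒≤ deficient)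

      W′⊆W∩W′ : W′ ⊆ W ∩ W′
      W′⊆W∩W′ w∈W′ = x∈p∩q⁺ (W′⊆W w∈W′ , w∈W′)

      N[X″]⊆W─W′ : neighbours X″ J ⊆ W ─ W′
      N[X″]⊆W─W′ {t} t∈ with ∈-neighbours⁻ t∈
      ... | t∈J , y , y∈X″ , y~t = x∈p∧x∉q⇒x∈p─q (∈-neighbours⁺ t∈J y∈X y~t) λ t∈W′ →
            x∈p─q⇒x∉q X N′ y∈X″ (∈-neighbours⁺ y∈X t∈W′ (adjacent-sym G y~t))
        where
        y∈X : y ∈ X
        y∈X = p─q⊆p X N′ y∈X″

      ∣N[X″]∣≤ : ∣ neighbours X″ J ∣ ≤ ∣ W ─ W′ ∣
      ∣N[X″]∣≤ = p⊆q⇒∣p∣≤∣q∣ N[X″]⊆W─W′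

      W∩W′-nonempty : Nonempty (W ∩ W′)
      W∩W′-nonempty with 0<∣p∣⇒Nonempty (≤-<-trans z≤n deficient)
      ... | w , w∈W′ = w , W′⊆W∩W′ w∈W′

      IH : ∣ X″ ∣ ≤ ∣ neighbours X″ J ∣
      IH = Core-surplus-acc (rec (≤-<-trans ∣N[X″]∣≤ (p∩q≢∅⇒∣p─q∣<∣p∣ W W′ W∩W′-nonempty)))
                            (λ v∈X″ → X-core (p─q⊆p X N′ v∈X″))

    Core-surplus : ∀ {X} → CoreOutside X → ∣ X ∣ ≤ ∣ neighbours X J ∣
    Core-surplus = Core-surplus-acc (<-wellFounded _)

  Supp-maximum : IsC4kFree G → ∀ {I J} → Independent I → (∀ {v} → Supp G v → v ∈ I) →
                 IsInterWith I (Supp G) J → IsMaxIndepIn G (CSverts G) J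
  Supp-maximum C4k-free {I} {J} indI Supp⊆I J≡I∩Supp =
    ((λ v v∈J → inj₁ (J⊆Supp v∈J)) , indJ) ,
    λ K (K⊆CS , indK) → surplus⇒∣K∣≤∣J∣ indK (Core-surplus C4k-free Supp⊆J (K─J-core K⊆CS))
    where
    J⊆Supp : ∀ {v} → v ∈ J → Supp G v
    J⊆Supp v∈J = proj₂ (proj₁ (J≡I∩Supp _) v∈J)
    Supp⊆J : ∀ {v} → Supp G v → v ∈ J
    Supp⊆J supp = proj₂ (J≡I∩Supp _) (Supp⊆I supp , supp)
    indJ : Independent J
    indJ u v u∈J v∈J = indI u v (Supp⊆I (J⊆Supp u∈J)) (Supp⊆I (J⊆Supp v∈J))
    K─J-core : ∀ {K} → (∀ v → v ∈ K → CSverts G v) → ∀ {v} → v ∈ K ─ J → Core G v × v ∉ J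
    K─J-core {K} K⊆CS {v} v∈K─J with K⊆CS v (p─q⊆p K J v∈K─J)
    ... | inj₁ supp = contradiction (Supp⊆J supp) (x∈p─q⇒x∉q K J v∈K─J)
    ... | inj₂ core = core , x∈p─q⇒x∉q K J v∈K─J

corollary6p6 : ∀ {n : ℕ} (G : Graph n) → IsBipartite G → IsC4kFree G →
    ∀ (I : Subset n) → IsMaxIndepIn G (λ _ → ⊤) I →
    (∀ (J : Subset n) → IsInterWith I (Npart G) J → IsMaxIndepIn G (Npart G) J) ×
    (∀ (J : Subset n) → IsInterWith I (Supp G) J → IsMaxIndepIn G (CSverts G) J)
corollary6p6 G bipartite C4k-free I maximum =
  (λ J → Npart-maximum G maximum Supp⊆I) ,
  (λ J → Supp-maximum G C4k-free (proj₂ (proj₁ maximum)) Supp⊆I)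
  where
  Supp⊆I : ∀ {v} → Supp G v → v ∈ I
  Supp⊆I = Supp⊆maximum G maximum bipartite C4k-free
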